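{- Let $B=\{1,2,\dots,15\}\in\triangle_5$. If $X,Y\subseteq B$ are disjoint, then it is not the case that both $X$ contains some element of $\triangle_3(B)$ and $Y$ contains some element of $\triangle_3(B)$. (That is, in Mines$_5(3)$ both players cannot construct a $\triangle_3$.)
   Context: $T_n=n(n+1)/2$, $T_0=0$. A finite set $X\subseteq\mathbb{N}$ with $|X|=T_n$, enumerated $x_1<\dots<x_{T_n}$, has $i$-th level $\{x_{T_{i-1}+1},\dots,x_{T_i}\}$ for $1\le i\le n$; $\triangle_n$ is the set of all $X\subseteq\mathbb{N}$ with $|X|=T_n$. For such sets, $X\le Y$ means $X\subseteq Y$ and every level of $X$ is contained in a single level of $Y$, distinct levels of $X$ being contained in distinct levels of $Y$; $\triangle_k(B)=\{Z\in\triangle_k:Z\le B\}$. -}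

module Defs where

open import Data.Nat using (ℕ; zero; suc; _+_; _<_)
open import Data.Fin using (Fin; toℕ)
open import Data.List using (List; length; take; drop; map; upTo)
open import Data.List.Relation.Unary.All using (All)
open import Data.List.Relation.Unary.Linked using (Linked)
open import Data.List.Membership.Propositional using (_∈_)
open import Data.Product using (Σ; _×_)
open import Function.Definitions using (Injective)
open import Relation.Binary.PropositionalEquality using (_≡_)

T : ℕ → ℕ
T zero    = 0
T (suc n) = T n + suc n

-- A finite subset of ℕ is represented by its increasing enumeration x₁ < … < x_m.
-- X ∈ △ₙ : the enumeration is strictly increasing and has T n elements.
InTri : ℕ → List ℕ → Set
InTri n xs = Linked _<_ xs × length xs ≡ T n

-- The (i+1)-th level (i : Fin n, 0-based) : {x_{T i + 1}, …, x_{T (i+1)}}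
level : List ℕ → ℕ → List ℕ
level xs i = take (suc i) (drop (T i) xs)

_⊆ₗ_ : List ℕ → List ℕ → Set
xs ⊆ₗ ys = All (λ x → x ∈ ys) xs

Le : (k n : ℕ) → List ℕ → List ℕ → Set
Le k n X Y =
  InTri k X × InTri n Y × X ⊆ₗ Y ×
  Σ (Fin k → Fin n) (λ f → Injective _≡_ _≡_ f ×
     ((i : Fin k) → level X (toℕ i) ⊆ₗ level Y (toℕ (f i))))

InTriOf : ℕ → ℕ → List ℕ → List ℕ → Set
InTriOf k n B Z = Le k n Z B

B15 : List ℕ
B15 = map suc (upTo 15)

-- Since the enumeration of a △₃ inside B is increasing, the map sending each of its
-- levels to the level of B containing it is strictly increasing, Fin 3 → Fin 5. For
-- any two such maps some level i of the one and some level i′ of the other land in a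
-- common level j of B with (i + 1) + (i′ + 1) > j + 1 (a check over the ten maps), so
-- by pigeonhole those two levels of the two players' sets must share a point.
module Submission where

open import Defs
open import Data.Nat using (ℕ; suc; _+_; _∸_; _⊓_; _≤_; _<_; _≤?_; z≤n; s≤s; z<s; s<s)
open import Data.Nat.Properties
  using (+-mono-≤; +-comm; +-suc; m≤n⇒m⊓n≡m; m+n≤o⇒m≤o∸n; ≮⇒≥; <-trans; <-asym; <⇒≱; ≤-pred)
  renaming (<⇒≢ to <⇒≢ℕ)
open import Data.Fin as Fin using (Fin; toℕ)
open import Data.Fin.Patterns using (0F; 1F; 2F)
open import Data.Fin.Properties using (all?; any?; _≟_; _<?_; toℕ<n; ≤∧≢⇒<; <⇒≢)
open import Data.List using (List; []; _∷_; length; take; drop)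
open import Data.List.Properties
  using (length-take; length-drop; length-++; length-removeAt′; drop-drop; take++drop≡id)
open import Data.List.Membership.Propositional using (_∈_)
open import Data.List.Membership.Propositional.Properties using (∈-++⁺ˡ; ∈-++⁺ʳ)
open import Data.List.Relation.Unary.Any using (here; there; index; _─_)
open import Data.List.Relation.Unary.All as All using (All; []; _∷_)
import Data.List.Relation.Unary.All.Properties as All
open import Data.List.Relation.Unary.AllPairs as AllPairs using (AllPairs; []; _∷_)
import Data.List.Relation.Unary.AllPairs.Properties as AllPairs
open import Data.List.Relation.Unary.Linked using (Linked)
open import Data.List.Relation.Unary.Linked.Properties using (Linked⇒AllPairs)
open import Data.List.Relation.Unary.Unique.Propositional using (Unique)
import Data.List.Relation.Unary.Unique.Propositional.Properties as Unique
open import Data.List.Relation.Binary.Disjoint.Propositional using (Disjoint)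
open import Data.Product using (Σ; ∃; ∃₂; _×_; _,_; proj₁)
open import Data.Empty using (⊥; ⊥-elim)
open import Data.Unit using (tt)
open import Function using (_∘_)
open import Function.Definitions using (Injective)
open import Relation.Nullary using (¬_; Dec)
open import Relation.Nullary.Decidable using (toWitness; _×-dec_; _→-dec_)
open import Relation.Binary.Core using (_Preserves_⟶_)
open import Relation.Binary.PropositionalEquality
  using (_≡_; _≢_; refl; sym; trans; cong; cong₂; subst; module ≡-Reasoning)

private
  variable
    A : Set
    R : A → A → Set
    x y : A
    xs ys zs : List A
    k l m n : ℕ

∈-─ : (p : x ∈ zs) → y ∈ zs → y ≢ x → y ∈ (zs ─ p)
∈-─ (here refl) (here refl) y≢x = ⊥-elim (y≢x refl)
∈-─ (here refl) (there q)   _   = q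
∈-─ (there p)   (here refl) _   = here refl
∈-─ (there p)   (there q)   y≢x = there (∈-─ p q y≢x)

unique⊆⇒length≤ : Unique xs → All (_∈ zs) xs → length xs ≤ length zs
unique⊆⇒length≤ [] [] = z≤n
unique⊆⇒length≤ {zs = zs} (x∉xs ∷ xs!) (x∈zs ∷ xs⊆zs) =
  subst (_ ≤_) (sym (length-removeAt′ zs (index x∈zs)))
    (s≤s (unique⊆⇒length≤ xs!
      (All.zipWith (λ (x≢y , y∈zs) → ∈-─ x∈zs y∈zs (x≢y ∘ sym)) (x∉xs , xs⊆zs))))

disjoint⊆⇒length+≤ : Unique xs → Unique ys → Disjoint xs ys →
                     All (_∈ zs) xs → All (_∈ zs) ys → length xs + length ys ≤ length zs
disjoint⊆⇒length+≤ {xs = xs} xs! ys! xs∩ys=∅ xs⊆zs ys⊆zs =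
  subst (_≤ _) (length-++ xs) (unique⊆⇒length≤ (Unique.++⁺ xs! ys! xs∩ys=∅) (All.++⁺ xs⊆zs ys⊆zs))

∈-take⇒∈ : ∀ m → x ∈ take m xs → x ∈ xs
∈-take⇒∈ {xs = xs} m p = subst (_ ∈_) (take++drop≡id m xs) (∈-++⁺ˡ p)

∈-drop⇒∈ : ∀ m → x ∈ drop m xs → x ∈ xs
∈-drop⇒∈ {xs = xs} m p = subst (_ ∈_) (take++drop≡id m xs) (∈-++⁺ʳ (take m xs) p)

∈-drop-mono : m ≤ n → x ∈ drop n xs → x ∈ drop m xs
∈-drop-mono {n = n} z≤n p = ∈-drop⇒∈ n p
∈-drop-mono {xs = _ ∷ _} (s≤s m≤n) p = ∈-drop-mono m≤n p

AllPairs-take-drop : ∀ m → AllPairs R xs → x ∈ take m xs → y ∈ drop m xs → R x y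
AllPairs-take-drop (suc m) (Rx ∷ _)  (here refl) y∈ = All.lookup (All.drop⁺ m Rx) y∈
AllPairs-take-drop (suc m) (_ ∷ Rxs) (there x∈)  y∈ = AllPairs-take-drop m Rxs x∈ y∈

T-mono-≤ : m ≤ n → T m ≤ T n
T-mono-≤ z≤n       = z≤n
T-mono-≤ (s≤s m≤n) = +-mono-≤ (T-mono-≤ m≤n) (s≤s m≤n)

length-level : ∀ (xs : List ℕ) i → T (suc i) ≤ length xs → length (level xs i) ≡ suc i
length-level xs i T[1+i]≤len = begin
  length (take (suc i) (drop (T i) xs))  ≡⟨ length-take (suc i) (drop (T i) xs) ⟩
  suc i ⊓ length (drop (T i) xs)         ≡⟨ cong (suc i ⊓_) (length-drop (T i) xs) ⟩
  suc i ⊓ (length xs ∸ T i)              ≡⟨ m≤n⇒m⊓n≡m (m+n≤o⇒m≤o∸n (suc i) 1+i+T[i]≤len) ⟩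
  suc i                                  ∎
  where
  open ≡-Reasoning
  1+i+T[i]≤len : suc i + T i ≤ length xs
  1+i+T[i]≤len = subst (_≤ length xs) (+-comm (T i) (suc i)) T[1+i]≤len

level-below : AllPairs R xs → ∀ {i j} → i < j → x ∈ level xs i → y ∈ level xs j → R x y
level-below {xs = xs} sorted {i} {j} i<j x∈ y∈ =
  AllPairs-take-drop (suc i) (AllPairs.drop⁺ (T i) sorted) x∈
    (subst (_ ∈_) (sym (drop-drop (T i) (suc i) xs))
      (∈-drop-mono (T-mono-≤ i<j) (∈-take⇒∈ (suc j) y∈)))

All-level : {P : ℕ → Set} {xs : List ℕ} → All P xs → ∀ i → All P (level xs i)
All-level Pxs i = All.take⁺ (suc i) (All.drop⁺ (T i) Pxs)

Linked<⇒AllPairs : {xs : List ℕ} → Linked _<_ xs → AllPairs _<_ xs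
Linked<⇒AllPairs = Linked⇒AllPairs <-trans

Linked<⇒unique-level : {xs : List ℕ} → Linked _<_ xs → ∀ i → Unique (level xs i)
Linked<⇒unique-level sorted i =
  Unique.take⁺ (suc i) (Unique.drop⁺ (T i) (AllPairs.map <⇒≢ℕ (Linked<⇒AllPairs sorted)))

length-level-△ : {xs : List ℕ} → InTri k xs → (i : Fin k) → length (level xs (toℕ i)) ≡ suc (toℕ i)
length-level-△ {xs = xs} (_ , len) i = length-level xs (toℕ i)
  (subst (T (suc (toℕ i)) ≤_) (sym len) (T-mono-≤ (toℕ<n i)))

level-inhabited : {xs : List ℕ} → InTri k xs → (i : Fin k) → ∃ (_∈ level xs (toℕ i))
level-inhabited {xs = xs} xs∈△ i with level xs (toℕ i) | length-level-△ xs∈△ i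
... | x ∷ _ | _ = x , here refl

levelMap-monotone : {xs ys : List ℕ} → InTri k xs → InTri n ys →
                    {f : Fin k → Fin n} → Injective _≡_ _≡_ f →
                    (∀ i → level xs (toℕ i) ⊆ₗ level ys (toℕ (f i))) →
                    f Preserves Fin._<_ ⟶ Fin._<_
levelMap-monotone xs∈△ ys∈△ {f} f-inj xs⊆ys {i} {j} i<j
  with level-inhabited xs∈△ i | level-inhabited xs∈△ j
... | x , x∈ | y , y∈ = ≤∧≢⇒< (≮⇒≥ f[j]≮f[i]) (<⇒≢ i<j ∘ f-inj)
  where
  f[j]≮f[i] : ¬ toℕ (f j) < toℕ (f i)
  f[j]≮f[i] f[j]<f[i] =
    <-asym (level-below (Linked<⇒AllPairs (proj₁ xs∈△)) i<j x∈ y∈)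
           (level-below (Linked<⇒AllPairs (proj₁ ys∈△)) f[j]<f[i]
                        (All.lookup (xs⊆ys j) y∈) (All.lookup (xs⊆ys i) x∈))

disjoint-levels-fit : {xs ys zs : List ℕ} → InTri k xs → InTri l ys → InTri n zs →
                      (i : Fin k) (i′ : Fin l) (j : Fin n) →
                      Disjoint (level xs (toℕ i)) (level ys (toℕ i′)) →
                      level xs (toℕ i) ⊆ₗ level zs (toℕ j) → level ys (toℕ i′) ⊆ₗ level zs (toℕ j) →
                      toℕ i + toℕ i′ < toℕ j
disjoint-levels-fit {xs = xs} {ys} {zs} xs∈△ ys∈△ zs∈△ i i′ j disjoint xs⊆zs ys⊆zs = ≤-pred (begin
  suc (suc (toℕ i + toℕ i′))                             ≡⟨ cong suc (+-suc (toℕ i) (toℕ i′)) ⟨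
  suc (toℕ i) + suc (toℕ i′)                             ≡⟨ cong₂ _+_ (length-level-△ xs∈△ i)
                                                                      (length-level-△ ys∈△ i′) ⟨
  length (level xs (toℕ i)) + length (level ys (toℕ i′)) ≤⟨ fits ⟩
  length (level zs (toℕ j))                              ≡⟨ length-level-△ zs∈△ j ⟩
  suc (toℕ j)                                            ∎)
  where
  open Data.Nat.Properties.≤-Reasoning
  fits : length (level xs (toℕ i)) + length (level ys (toℕ i′)) ≤ length (level zs (toℕ j))
  fits = disjoint⊆⇒length+≤ (Linked<⇒unique-level (proj₁ xs∈△) (toℕ i))
                            (Linked<⇒unique-level (proj₁ ys∈△) (toℕ i′)) disjoint xs⊆zs ys⊆zs

-- Levels i and i′ share the level j = f i = g i′ of B, which has j + 1 < (i + 1) + (i′ + 1) points.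
Collision : (f g : Fin 3 → Fin 5) → Set
Collision f g = ∃₂ λ i i′ → f i ≡ g i′ × toℕ (f i) ≤ toℕ i + toℕ i′

triple : Fin 5 → Fin 5 → Fin 5 → Fin 3 → Fin 5
triple a b c 0F = a
triple a b c 1F = b
triple a b c 2F = c

collision? : ∀ f g → Dec (Collision f g)
collision? f g = any? λ i → any? λ i′ → f i ≟ g i′ ×-dec toℕ (f i) ≤? toℕ i + toℕ i′

-- Opaque, so that the type checker never unfolds the decision procedure at use sites.
opaque
  collision-triple : ∀ a b → a Fin.< b → ∀ c → b Fin.< c →
                     ∀ a′ b′ → a′ Fin.< b′ → ∀ c′ → b′ Fin.< c′ →
                     Collision (triple a b c) (triple a′ b′ c′)
  collision-triple = toWitness {a? =
    all? λ a → all? λ b → a <? b →-dec all? λ c → b <? c →-dec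
    all? λ a′ → all? λ b′ → a′ <? b′ →-dec all? λ c′ → b′ <? c′ →-dec
    collision? (triple a b c) (triple a′ b′ c′)} tt

triple-η : (f : Fin 3 → Fin 5) → ∀ i → triple (f 0F) (f 1F) (f 2F) i ≡ f i
triple-η f 0F = refl
triple-η f 1F = refl
triple-η f 2F = refl

Collision-triple-η : {f g : Fin 3 → Fin 5} →
                     Collision (triple (f 0F) (f 1F) (f 2F)) (triple (g 0F) (g 1F) (g 2F)) → Collision f g
Collision-triple-η {f} {g} (i , i′ , fi≡gi′ , fi≤i+i′) =
  i , i′ , trans (sym (triple-η f i)) (trans fi≡gi′ (triple-η g i′)) ,
  subst (λ v → toℕ v ≤ toℕ i + toℕ i′) (triple-η f i) fi≤i+i′

collision : {f g : Fin 3 → Fin 5} →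
            f Preserves Fin._<_ ⟶ Fin._<_ → g Preserves Fin._<_ ⟶ Fin._<_ → Collision f g
collision {f} {g} f-mono g-mono = Collision-triple-η
  (collision-triple (f 0F) (f 1F) (f-mono z<s) (f 2F) (f-mono (s<s z<s))
                    (g 0F) (g 1F) (g-mono z<s) (g 2F) (g-mono (s<s z<s)))

All-disjoint : {P Q : A → Set} → (∀ z → P z → Q z → ⊥) → All P xs → All Q ys → Disjoint xs ys
All-disjoint P∩Q=∅ Pxs Qys (v∈xs , v∈ys) = P∩Q=∅ _ (All.lookup Pxs v∈xs) (All.lookup Qys v∈ys)

theorem5 : (X Y : ℕ → Set) →
    (∀ x → X x → x ∈ B15) → (∀ y → Y y → y ∈ B15) →
    (∀ z → X z → Y z → ⊥) →
    ¬ (Σ (List ℕ) (λ Z → InTriOf 3 5 B15 Z × All X Z) ×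
    Σ (List ℕ) (λ W → InTriOf 3 5 B15 W × All Y W))
theorem5 X Y _ _ X∩Y=∅
  ((Z , (Z∈△ , B∈△ , _ , f , f-inj , Z⊆B) , XZ) , (W , (W∈△ , _ , _ , g , g-inj , W⊆B) , YW)) =
  let i , i′ , fi≡gi′ , fi≤i+i′ = collision (levelMap-monotone Z∈△ B∈△ f-inj Z⊆B)
                                            (levelMap-monotone W∈△ B∈△ g-inj W⊆B)
  in <⇒≱ (disjoint-levels-fit Z∈△ W∈△ B∈△ i i′ (f i)
           (All-disjoint X∩Y=∅ (All-level XZ (toℕ i)) (All-level YW (toℕ i′)))
           (Z⊆B i) (subst (λ j → level W (toℕ i′) ⊆ₗ level B15 (toℕ j)) (sym fi≡gi′) (W⊆B i′)))
         fi≤i+i′
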